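{- Let $E$ be a finite set with $|E| = n$ and let $\mathcal{H} = (E,\mathscr{H})$ be a hereditary collection. Then $\mathcal{H}$ is superboolean-representable by an $m\times n$ superboolean matrix for some $m$; that is, there exist $m$ and an $m \times n$ matrix $A$ with entries in $\mathbb{S} = \{0,1,1^\nu\}$, whose columns are labeled bijectively by the elements of $E$, such that for every $X \subseteq E$: $X \in \mathscr{H}$ if and only if there is a set $Y$ of rows of $A$ with $|Y| = |X|$ such that the $|X|\times|X|$ submatrix $A[Y,X]$ (rows $Y$, columns labeled by $X$) is nonsingular.
   Context: A hereditary collection is a pair $(E,\mathscr{H})$ where $E$ is a finite set and $\mathscr{H}\subseteq \mathcal{P}(E)$ is a nonempty family of subsets of $E$ such that $J'\subseteq J\in\mathscr{H}$ implies $J'\in\mathscr{H}$ (so $\emptyset\in\mathscr{H}$); members of $\mathscr{H}$ are called independent. The superboolean semiring $\mathbb{S}$ has elements $0,1,1^\nu$, with addition: $0+x=x$, $1+1=1^\nu$, $1+1^\nu=1^\nu+1^\nu=1^\nu$; multiplication: $0\cdot x=0$, $1\cdot x = x$, $1^\nu\cdot 1^\nu = 1^\nu$. For a square matrix $A=(a_{i,j})$ over $\mathbb{S}$ the permanent is $\mathrm{per}(A)=\sum_{\pi\in S_k} a_{\pi(1),1}\cdots a_{\pi(k),k}$ computed in $\mathbb{S}$; $A$ is nonsingular if $\mathrm{per}(A)=1$ (the empty $0\times 0$ matrix is regarded as nonsingular, so $\emptyset$ always qualifies). -}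

module Defs where

open import Data.Nat using (ℕ; zero; suc)
open import Data.Bool using (Bool; true; false; T)
open import Data.Fin using (Fin; zero; suc; cast)
open import Data.Fin.Subset using (Subset; _⊆_; ∣_∣)
open import Data.Vec using (Vec; []; _∷_)
open import Data.List using (List; []; _∷_; map; foldr; filter; concatMap; length; lookup)
open import Data.List.Relation.Unary.Unique.Propositional using (Unique)
open import Data.List.Relation.Unary.Unique.DecPropositional using (unique?)
open import Data.Fin.Properties using (_≟_)
open import Data.Product using (Σ; _×_)
open import Function.Bundles using (_⇔_)
import Data.Vec
open import Relation.Binary.PropositionalEquality using (_≡_; sym)

data 𝕊 : Set where
  𝟘 𝟙 𝟙ν : 𝕊

infixl 6 _⊕_
infixl 7 _⊗_

_⊕_ : 𝕊 → 𝕊 → 𝕊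
𝟘  ⊕ y  = y
𝟙  ⊕ 𝟘  = 𝟙
𝟙  ⊕ 𝟙  = 𝟙ν
𝟙  ⊕ 𝟙ν = 𝟙ν
𝟙ν ⊕ _  = 𝟙ν

_⊗_ : 𝕊 → 𝕊 → 𝕊
𝟘  ⊗ _  = 𝟘
𝟙  ⊗ y  = y
𝟙ν ⊗ 𝟘  = 𝟘
𝟙ν ⊗ 𝟙  = 𝟙ν
𝟙ν ⊗ 𝟙ν = 𝟙ν

Σ𝕊 : List 𝕊 → 𝕊
Σ𝕊 = foldr _⊕_ 𝟘

Π𝕊 : List 𝕊 → 𝕊
Π𝕊 = foldr _⊗_ 𝟙

-- Enumeration of the symmetric group S_k, as the list of all
-- injective maps π : Fin k → Fin k, given by their value lists
-- [π(0), …, π(k-1)] (each permutation occurs exactly once).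

allFin : (k : ℕ) → List (Fin k)
allFin k = Data.List.tabulate (λ i → i)

words : (k j : ℕ) → List (Vec (Fin k) j)
words k zero    = [] ∷ []
words k (suc j) = concatMap (λ w → map (λ x → x ∷ w) (allFin k)) (words k j)

perms : (k : ℕ) → List (Vec (Fin k) k)
perms k = filter (λ w → unique? _≟_ (Data.Vec.toList w)) (words k k)

per : (k : ℕ) → (Fin k → Fin k → 𝕊) → 𝕊
per k A = Σ𝕊 (map (λ π → Π𝕊 (map (λ j → A (Data.Vec.lookup π j) j) (allFin k))) (perms k))

Nonsingular : (k : ℕ) → (Fin k → Fin k → 𝕊) → Set
Nonsingular k A = per k A ≡ 𝟙

elems : {n : ℕ} → Subset n → List (Fin n)
elems {zero}  []          = []
elems {suc n} (true  ∷ p) = zero ∷ map suc (elems p)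
elems {suc n} (false ∷ p) = map suc (elems p)

record Hereditary (n : ℕ) : Set where
  field
    indep     : Subset n → Bool
    nonempty  : Σ (Subset n) (λ J → T (indep J))
    downclosed : ∀ {J′ J : Subset n} → J′ ⊆ J → T (indep J) → T (indep J′)

-- Submatrix A[Y,X] for a set Y of rows and a set X of columns with
-- |Y| = |X| (rows and columns taken in increasing order; the permanent
-- does not depend on the order).

subMatrix : {m n : ℕ} → (Fin m → Fin n → 𝕊) → (Y : Subset m) (X : Subset n) →
            length (elems Y) ≡ length (elems X) →
            Fin (length (elems X)) → Fin (length (elems X)) → 𝕊
subMatrix A Y X eq =
      (λ i j → A (lookup (elems Y) (cast (sym eq) i)) (lookup (elems X) j))

HasNonsingularSub : {m n : ℕ} → (Fin m → Fin n → 𝕊) → Subset n → Set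
HasNonsingularSub {m} A X =
  Σ (Subset m) (λ Y → Σ (length (elems Y) ≡ length (elems X))
                      (λ eq → Nonsingular (length (elems X)) (subMatrix A Y X eq)))

Represents : {m n : ℕ} → (Fin m → Fin n → 𝕊) → Hereditary n → Set
Represents {m} {n} A H =
  (X : Subset n) → T (Hereditary.indep H X) ⇔ HasNonsingularSub A X

module Submission where

open import Defs
open import Data.Nat using (ℕ; zero; suc; pred; _+_; _*_)
open import Data.Nat.Properties using (+-comm; +-suc; n<1+n; m≤n⇒∃[o]m+o≡n)
open import Data.Nat.GeneralisedArithmetic using (fold; fold-+)
open import Data.Bool using (true; false; T; _∧_; if_then_else_)
open import Data.Bool.Properties using (T-≡)
open import Function.Bundles using (Equivalence; mk⇔)
open import Data.Fin using (Fin; zero; suc; cast; toℕ; _↑ˡ_; _↑ʳ_; combine; remQuot)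
open import Data.Fin.Properties using (_≟_; all?; ¬∀⟶∃¬; pigeonhole; suc-injective; remQuot-combine)
open import Data.Fin.Subset using (Subset; _⊆_; ⊥) renaming (_∈_ to _∈ₛ_; _∉_ to _∉ₛ_)
open import Data.Fin.Subset.Properties using (_∈?_)
open import Data.Product using (Σ; ∃; ∃₂; _×_; _,_; proj₁; proj₂)
open import Data.Sum using (_⊎_; inj₁; inj₂)
open import Data.Empty using (⊥-elim)
open import Data.Vec as Vec using (Vec; []; _∷_; _++_; here; there; tabulate; toList)
open import Data.Vec.Properties using (∷-injective; lookup∘tabulate; tabulate∘lookup; tabulate-cong)
import Data.Vec.Relation.Unary.All.Properties as VecAll
import Data.Vec.Relation.Unary.Unique.Propositional as VecU
open import Data.Vec.Relation.Unary.AllPairs using ([]; _∷_)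
import Data.Vec.Relation.Unary.Unique.Propositional.Properties as VecU
open import Data.List as List using (List; []; _∷_; map; concatMap; cartesianProductWith; length)
open import Data.List.Properties using (map-id; map-∘; ++-identityʳ; length-map)
open import Data.List.Relation.Unary.All as All using (All; []; _∷_)
import Data.List.Relation.Unary.All.Properties as AllP
open import Data.List.Relation.Unary.Any as Any using (here; there)
open import Data.List.Relation.Unary.Any.Properties using (lookup-index)
open import Data.List.Membership.Propositional using (_∈_)
open import Data.List.Membership.Propositional.Properties
  using (∈-map⁺; ∈-map⁻; ∈-filter⁺; ∈-filter⁻; ∈-cartesianProductWith⁺; ∈-allFin; ∈-lookup)
open import Data.List.Relation.Unary.Unique.Propositional using (Unique)
open import Data.List.Relation.Unary.AllPairs using ([]; _∷_)
open import Data.List.Relation.Unary.Unique.Propositional.Properties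
  using (map⁺; cartesianProductWith⁺; filter⁺; allFin⁺)
open import Data.List.Relation.Unary.Unique.DecPropositional using (unique?)
open import Relation.Binary.PropositionalEquality
open import Relation.Nullary using (¬_; Dec; yes; no)
open import Relation.Nullary.Decidable using (does; T?; _→-dec_; decidable-stable; dec-true; dec-false)
open import Function using (_∘_; id)

-- Row (J, j) of the matrix is zero unless J is independent and j ∈ J; then
-- it reads 𝟙 at j, 𝟘 on J ∖ {j} and 𝟙ν off J. An independent X picks the rows
-- (X, x), x ∈ X, which form an identity submatrix. Conversely, if a square
-- submatrix on the columns of a dependent X has permanent 𝟙, some permutation π
-- picks only entries 𝟙, so every chosen row (J, j) has J independent and
-- j ∈ J; as X ⊈ J, that row has an entry 𝟙ν in a column f(c) of X. Rerouting
-- π along a cycle of f yields a permutation whose term is 𝟙ν, so the permanent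
-- is 𝟙ν after all.

𝟘≢𝟙 : 𝟘 ≢ 𝟙
𝟘≢𝟙 ()

𝟙≢𝟙ν : 𝟙 ≢ 𝟙ν
𝟙≢𝟙ν ()

𝟙ν≢𝟘 : 𝟙ν ≢ 𝟘
𝟙ν≢𝟘 ()

⊕-𝟙ν : ∀ x → x ⊕ 𝟙ν ≡ 𝟙ν
⊕-𝟙ν 𝟘  = refl
⊕-𝟙ν 𝟙  = refl
⊕-𝟙ν 𝟙ν = refl

⊗-𝟘 : ∀ x → x ⊗ 𝟘 ≡ 𝟘
⊗-𝟘 𝟘  = refl
⊗-𝟘 𝟙  = refl
⊗-𝟘 𝟙ν = refl

𝟙ν⊗≢𝟙 : ∀ y → 𝟙ν ⊗ y ≢ 𝟙
𝟙ν⊗≢𝟙 𝟘 ()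
𝟙ν⊗≢𝟙 𝟙 ()
𝟙ν⊗≢𝟙 𝟙ν ()

𝟙ν⊗-nonzero : ∀ {y} → y ≢ 𝟘 → 𝟙ν ⊗ y ≡ 𝟙ν
𝟙ν⊗-nonzero {𝟘}  y≢𝟘 = ⊥-elim (y≢𝟘 refl)
𝟙ν⊗-nonzero {𝟙}  _   = refl
𝟙ν⊗-nonzero {𝟙ν} _   = refl

nonzero⊗𝟙ν : ∀ {x} → x ≢ 𝟘 → x ⊗ 𝟙ν ≡ 𝟙ν
nonzero⊗𝟙ν {𝟘}  x≢𝟘 = ⊥-elim (x≢𝟘 refl)
nonzero⊗𝟙ν {𝟙}  _   = refl
nonzero⊗𝟙ν {𝟙ν} _   = refl

Σ𝕊-𝟙ν : ∀ {xs} → 𝟙ν ∈ xs → Σ𝕊 xs ≡ 𝟙ν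
Σ𝕊-𝟙ν (here refl)        = refl
Σ𝕊-𝟙ν {x ∷ _} (there p) = trans (cong (x ⊕_) (Σ𝕊-𝟙ν p)) (⊕-𝟙ν x)

Σ𝕊≡𝟙⇒𝟙∈ : ∀ xs → Σ𝕊 xs ≡ 𝟙 → 𝟙 ∈ xs
Σ𝕊≡𝟙⇒𝟙∈ (𝟘 ∷ xs) e = there (Σ𝕊≡𝟙⇒𝟙∈ xs e)
Σ𝕊≡𝟙⇒𝟙∈ (𝟙 ∷ xs) e = here refl

Σ𝕊-𝟘 : ∀ {xs} → All (_≡ 𝟘) xs → Σ𝕊 xs ≡ 𝟘
Σ𝕊-𝟘 []           = refl
Σ𝕊-𝟘 (refl ∷ p) = Σ𝕊-𝟘 p

module _ {A : Set} (g : A → 𝕊) {v : A}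
         (gv≡𝟙 : g v ≡ 𝟙) (others≡𝟘 : ∀ x → g x ≡ 𝟘 ⊎ x ≡ v) where

  private
    g≡𝟘 : ∀ {x} → v ≢ x → g x ≡ 𝟘
    g≡𝟘 {x} v≢x with others≡𝟘 x
    ... | inj₁ gx≡𝟘 = gx≡𝟘
    ... | inj₂ x≡v  = ⊥-elim (v≢x (sym x≡v))

  Σ𝕊-map-single𝟙 : ∀ {xs} → Unique xs → v ∈ xs → Σ𝕊 (map g xs) ≡ 𝟙
  Σ𝕊-map-single𝟙 (v∉xs ∷ _) (here refl) rewrite gv≡𝟙 =
    cong (𝟙 ⊕_) (Σ𝕊-𝟘 (AllP.map⁺ (All.map g≡𝟘 v∉xs)))
  Σ𝕊-map-single𝟙 (x∉xs ∷ u) (there v∈xs) rewrite g≡𝟘 (All.lookup x∉xs v∈xs ∘ sym) =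
    Σ𝕊-map-single𝟙 u v∈xs

Π𝕊-𝟘 : ∀ {xs} → 𝟘 ∈ xs → Π𝕊 xs ≡ 𝟘
Π𝕊-𝟘 (here refl)        = refl
Π𝕊-𝟘 {x ∷ _} (there p) = trans (cong (x ⊗_) (Π𝕊-𝟘 p)) (⊗-𝟘 x)

Π𝕊-𝟙 : ∀ {xs} → All (_≡ 𝟙) xs → Π𝕊 xs ≡ 𝟙
Π𝕊-𝟙 []           = refl
Π𝕊-𝟙 (refl ∷ p) = Π𝕊-𝟙 p

Π𝕊≡𝟙⇒ : ∀ xs → Π𝕊 xs ≡ 𝟙 → All (_≡ 𝟙) xs
Π𝕊≡𝟙⇒ []        _  = []
Π𝕊≡𝟙⇒ (𝟘 ∷ xs)  ()
Π𝕊≡𝟙⇒ (𝟙 ∷ xs)  e  = refl ∷ Π𝕊≡𝟙⇒ xs e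
Π𝕊≡𝟙⇒ (𝟙ν ∷ xs) e  = ⊥-elim (𝟙ν⊗≢𝟙 (Π𝕊 xs) e)

Π𝕊-nonzero : ∀ {xs} → All (_≢ 𝟘) xs → Π𝕊 xs ≢ 𝟘
Π𝕊-nonzero []                   ()
Π𝕊-nonzero {𝟘 ∷ _}  (x≢𝟘 ∷ _) = ⊥-elim (x≢𝟘 refl)
Π𝕊-nonzero {𝟙 ∷ _}  (_ ∷ p)   = Π𝕊-nonzero p
Π𝕊-nonzero {𝟙ν ∷ _} (_ ∷ p)   = 𝟙ν≢𝟘 ∘ trans (sym (𝟙ν⊗-nonzero (Π𝕊-nonzero p)))

Π𝕊-𝟙ν : ∀ {xs} → All (_≢ 𝟘) xs → 𝟙ν ∈ xs → Π𝕊 xs ≡ 𝟙ν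
Π𝕊-𝟙ν (_ ∷ p)     (here refl) = 𝟙ν⊗-nonzero (Π𝕊-nonzero p)
Π𝕊-𝟙ν {x ∷ _} (x≢𝟘 ∷ p) (there q) = trans (cong (x ⊗_) (Π𝕊-𝟙ν p q)) (nonzero⊗𝟙ν x≢𝟘)

concatMap-map≡cartesianProductWith : ∀ {A B C : Set} (f : A → B → C) xs ys →
  concatMap (λ x → map (f x) ys) xs ≡ cartesianProductWith f xs ys
concatMap-map≡cartesianProductWith f []       ys = refl
concatMap-map≡cartesianProductWith f (x ∷ xs) ys =
  cong (map (f x) ys List.++_) (concatMap-map≡cartesianProductWith f xs ys)

words-suc : ∀ k j → words k (suc j) ≡ cartesianProductWith (λ w x → x ∷ w) (words k j) (allFin k)
words-suc k j = concatMap-map≡cartesianProductWith (λ w x → x ∷ w) (words k j) (allFin k)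

∈-words : ∀ {k j} (w : Vec (Fin k) j) → w ∈ words k j
∈-words []      = here refl
∈-words {k} {suc j} (x ∷ w) rewrite words-suc k j =
  ∈-cartesianProductWith⁺ (λ w x → x ∷ w) (∈-words w) (∈-allFin x)

words-unique : ∀ k j → Unique (words k j)
words-unique k zero    = [] ∷ []
words-unique k (suc j) rewrite words-suc k j =
  cartesianProductWith⁺ (λ w x → x ∷ w) (λ e → let x≡y , w≡v = ∷-injective e in w≡v , x≡y)
    (words-unique k j) (allFin⁺ k)

Unique-toList⁺ : ∀ {A : Set} {k} {v : Vec A k} → VecU.Unique v → Unique (toList v)
Unique-toList⁺ []       = []
Unique-toList⁺ (p ∷ u) = VecAll.toList⁺ p ∷ Unique-toList⁺ u

Unique-toList⁻ : ∀ {A : Set} {k} {v : Vec A k} → Unique (toList v) → VecU.Unique v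
Unique-toList⁻ {v = []}    []       = []
Unique-toList⁻ {v = _ ∷ _} (p ∷ u) = VecAll.toList⁻ p ∷ Unique-toList⁻ u

∈-perms⁺ : ∀ {k} {π : Vec (Fin k) k} → VecU.Unique π → π ∈ perms k
∈-perms⁺ {π = π} u = ∈-filter⁺ (λ w → unique? _≟_ (toList w)) (∈-words π) (Unique-toList⁺ u)

∈-perms⁻ : ∀ {k} {π : Vec (Fin k) k} → π ∈ perms k → VecU.Unique π
∈-perms⁻ {k} p =
  Unique-toList⁻ (proj₂ (∈-filter⁻ (λ w → unique? _≟_ (toList w)) {xs = words k k} p))

perms-unique : ∀ k → Unique (perms k)
perms-unique k = filter⁺ (λ w → unique? _≟_ (toList w)) (words-unique k k)

permTerm : ∀ {k} → (Fin k → Fin k → 𝕊) → Vec (Fin k) k → 𝕊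
permTerm {k} A π = Π𝕊 (map (λ j → A (Vec.lookup π j) j) (allFin k))

module _ {k} (A : Fin k → Fin k → 𝕊) (π : Vec (Fin k) k) where

  private
    diagonal : Fin k → 𝕊
    diagonal j = A (Vec.lookup π j) j

    ∈-diagonal : ∀ j → diagonal j ∈ map diagonal (allFin k)
    ∈-diagonal j = ∈-map⁺ diagonal (∈-allFin j)

  permTerm-𝟘 : ∀ j → A (Vec.lookup π j) j ≡ 𝟘 → permTerm A π ≡ 𝟘
  permTerm-𝟘 j e = Π𝕊-𝟘 (subst (_∈ map diagonal (allFin k)) e (∈-diagonal j))

  permTerm-𝟙 : (∀ j → A (Vec.lookup π j) j ≡ 𝟙) → permTerm A π ≡ 𝟙
  permTerm-𝟙 ones = Π𝕊-𝟙 (AllP.map⁺ (All.universal ones (allFin k)))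

  permTerm≡𝟙⇒ : permTerm A π ≡ 𝟙 → ∀ j → A (Vec.lookup π j) j ≡ 𝟙
  permTerm≡𝟙⇒ e j = All.lookup (Π𝕊≡𝟙⇒ _ e) (∈-diagonal j)

  permTerm-𝟙ν : (∀ j → A (Vec.lookup π j) j ≢ 𝟘) →
                ∀ j → A (Vec.lookup π j) j ≡ 𝟙ν → permTerm A π ≡ 𝟙ν
  permTerm-𝟙ν nonzero j e =
    Π𝕊-𝟙ν (AllP.map⁺ (All.universal nonzero (allFin k)))
          (subst (_∈ map diagonal (allFin k)) e (∈-diagonal j))

per-identity : ∀ {k} (A : Fin k → Fin k → 𝕊) →
  (∀ i → A i i ≡ 𝟙) → (∀ i j → i ≢ j → A i j ≡ 𝟘) → per k A ≡ 𝟙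
per-identity {k} A diag off =
  Σ𝕊-map-single𝟙 (permTerm A) term-id term-other (perms-unique k) (∈-perms⁺ (VecU.tabulate⁺ id))
  where
  term-id : permTerm A (tabulate id) ≡ 𝟙
  term-id = permTerm-𝟙 A (tabulate id) λ j →
    subst (λ i → A i j ≡ 𝟙) (sym (lookup∘tabulate id j)) (diag j)
  term-other : ∀ π → permTerm A π ≡ 𝟘 ⊎ π ≡ tabulate id
  term-other π with all? (λ j → Vec.lookup π j ≟ j)
  ... | yes fixed = inj₂ (trans (sym (tabulate∘lookup π)) (tabulate-cong fixed))
  ... | no ¬fixed with ¬∀⟶∃¬ k _ (λ j → Vec.lookup π j ≟ j) ¬fixed
  ... | j , πj≢j = inj₁ (permTerm-𝟘 A π j (off _ _ πj≢j))

per≡𝟙⇒ : ∀ {k} (A : Fin k → Fin k → 𝕊) → per k A ≡ 𝟙 →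
  ∃ λ π → π ∈ perms k × ∀ c → A (Vec.lookup π c) c ≡ 𝟙
per≡𝟙⇒ A per≡𝟙 with ∈-map⁻ (permTerm A) (Σ𝕊≡𝟙⇒𝟙∈ _ per≡𝟙)
... | π , π∈perms , 𝟙≡term = π , π∈perms , permTerm≡𝟙⇒ A π (sym 𝟙≡term)

∃-periodicPoint : ∀ {k} (f : Fin k → Fin k) → Fin k → ∃₂ λ ℓ y → fold y f (suc ℓ) ≡ y
∃-periodicPoint {k} f x with pigeonhole (n<1+n k) (λ i → fold x f (toℕ i))
... | i , j , i<j , fⁱx≡fʲx with m≤n⇒∃[o]m+o≡n i<j
... | ℓ , 1+i+ℓ≡j = ℓ , fold x f (toℕ i) , (begin
  fold (fold x f (toℕ i)) f (suc ℓ) ≡⟨ sym (fold-+ x f (suc ℓ)) ⟩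
  fold x f (suc ℓ + toℕ i)          ≡⟨ cong (fold x f) (+-comm (suc ℓ) (toℕ i)) ⟩
  fold x f (toℕ i + suc ℓ)          ≡⟨ cong (fold x f) (trans (+-suc (toℕ i) ℓ) 1+i+ℓ≡j) ⟩
  fold x f (toℕ j)                  ≡⟨ sym fⁱx≡fʲx ⟩
  fold x f (toℕ i)                  ∎)
  where open ≡-Reasoning

module Rewind {k} (f : Fin k → Fin k) (ℓ : ℕ) where

  Periodic : Fin k → Set
  Periodic y = fold y f (suc ℓ) ≡ y

  periodic? : ∀ y → Dec (Periodic y)
  periodic? y = fold y f (suc ℓ) ≟ y

  -- f ^ ℓ inverts f on the periodic points
  rewind : ∀ y → Dec (Periodic y) → Fin k
  rewind y (yes _) = fold y f ℓ
  rewind y (no _)  = y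

  periodic-fold : ∀ {y} → Periodic y → Periodic (fold y f ℓ)
  periodic-fold {y} p = begin
    fold (fold y f ℓ) f (suc ℓ) ≡⟨ sym (fold-+ y f (suc ℓ)) ⟩
    fold y f (suc ℓ + ℓ)         ≡⟨ cong (fold y f) (+-comm (suc ℓ) ℓ) ⟩
    fold y f (ℓ + suc ℓ)         ≡⟨ fold-+ y f ℓ ⟩
    fold (fold y f (suc ℓ)) f ℓ  ≡⟨ cong (λ z → fold z f ℓ) p ⟩
    fold y f ℓ                   ∎
    where open ≡-Reasoning

  rewind-injective : ∀ y z (y? : Dec (Periodic y)) (z? : Dec (Periodic z)) →
                     rewind y y? ≡ rewind z z? → y ≡ z
  rewind-injective y z (yes py) (yes pz) e = trans (sym py) (trans (cong f e) pz)
  rewind-injective y z (yes py) (no ¬pz) e = ⊥-elim (¬pz (subst Periodic e (periodic-fold py)))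
  rewind-injective y z (no ¬py) (yes pz) e = ⊥-elim (¬py (subst Periodic (sym e) (periodic-fold pz)))
  rewind-injective y z (no _)   (no _)   e = e

-- σ reroutes π along a cycle of f: a periodic column y is served by the row
-- π (f⁻¹ y), whose entry there is 𝟙ν.
per-𝟙ν : ∀ {k} (A : Fin k → Fin k → 𝕊) (π : Vec (Fin k) k) → π ∈ perms k →
  (∀ c → A (Vec.lookup π c) c ≢ 𝟘) →
  (f : Fin k → Fin k) → (∀ c → A (Vec.lookup π c) (f c) ≡ 𝟙ν) → Fin k → per k A ≡ 𝟙ν
per-𝟙ν {k} A π π∈perms nonzero f hit x with ∃-periodicPoint f x
... | ℓ , y₀ , periodic-y₀ =
  Σ𝕊-𝟙ν (subst (_∈ map (permTerm A) (perms k)) term-σ (∈-map⁺ (permTerm A) σ∈perms))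
  where
  open Rewind f ℓ

  σ : Vec (Fin k) k
  σ = tabulate (λ y → Vec.lookup π (rewind y (periodic? y)))

  σ∈perms : σ ∈ perms k
  σ∈perms = ∈-perms⁺ (VecU.tabulate⁺ λ {y} {z} e →
    rewind-injective y z (periodic? y) (periodic? z) (VecU.lookup-injective (∈-perms⁻ π∈perms) _ _ e))

  entry-periodic : ∀ y → Periodic y → (y? : Dec (Periodic y)) →
                   A (Vec.lookup π (rewind y y?)) y ≡ 𝟙ν
  entry-periodic y py (yes _) =
    subst (λ z → A (Vec.lookup π (fold y f ℓ)) z ≡ 𝟙ν) py (hit (fold y f ℓ))
  entry-periodic y py (no ¬py) = ⊥-elim (¬py py)

  entry-nonzero : ∀ y (y? : Dec (Periodic y)) → A (Vec.lookup π (rewind y y?)) y ≢ 𝟘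
  entry-nonzero y (yes py) = subst (_≢ 𝟘) (sym (entry-periodic y py (yes py))) 𝟙ν≢𝟘
  entry-nonzero y (no _)   = nonzero y

  σ-entry : ∀ y → A (Vec.lookup σ y) y ≡ A (Vec.lookup π (rewind y (periodic? y))) y
  σ-entry y = cong (λ i → A i y) (lookup∘tabulate _ y)

  term-σ : permTerm A σ ≡ 𝟙ν
  term-σ = permTerm-𝟙ν A σ
    (λ y → subst (_≢ 𝟘) (sym (σ-entry y)) (entry-nonzero y (periodic? y)))
    y₀ (trans (σ-entry y₀) (entry-periodic y₀ periodic-y₀ (periodic? y₀)))

elems-sound : ∀ {n} (X : Subset n) {x} → x ∈ elems X → x ∈ₛ X
elems-sound (true ∷ X)  (here refl) = here
elems-sound (true ∷ X)  (there p) with ∈-map⁻ suc p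
... | _ , q , refl = there (elems-sound X q)
elems-sound (false ∷ X) p with ∈-map⁻ suc p
... | _ , q , refl = there (elems-sound X q)

elems-complete : ∀ {n} (X : Subset n) {x} → x ∈ₛ X → x ∈ elems X
elems-complete (true ∷ X)  here      = here refl
elems-complete (true ∷ X)  (there p) = there (∈-map⁺ suc (elems-complete X p))
elems-complete (false ∷ X) (there p) = ∈-map⁺ suc (elems-complete X p)

elems-unique : ∀ {n} (X : Subset n) → Unique (elems X)
elems-unique []          = []
elems-unique (true ∷ X)  =
  AllP.map⁺ (All.universal (λ _ ()) (elems X)) ∷ map⁺ suc-injective (elems-unique X)
elems-unique (false ∷ X) = map⁺ suc-injective (elems-unique X)

elems-⊥ : ∀ n → elems (⊥ {n}) ≡ []
elems-⊥ zero    = refl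
elems-⊥ (suc n) = cong (map suc) (elems-⊥ n)

map-suc-++ : ∀ {p q} (xs : List (Fin p)) (ys : List (Fin q)) →
  map suc (map (_↑ˡ q) xs List.++ map (p ↑ʳ_) ys) ≡
  map (_↑ˡ q) (map suc xs) List.++ map (suc p ↑ʳ_) ys
map-suc-++ []       ys = sym (map-∘ ys)
map-suc-++ {q = q} (x ∷ xs) ys = cong (suc (x ↑ˡ q) ∷_) (map-suc-++ xs ys)

elems-++ : ∀ {p q} (u : Subset p) (v : Subset q) →
  elems (u ++ v) ≡ map (_↑ˡ q) (elems u) List.++ map (p ↑ʳ_) (elems v)
elems-++ []          v = sym (map-id (elems v))
elems-++ (true ∷ u)  v =
  cong (zero ∷_) (trans (cong (map suc) (elems-++ u v)) (map-suc-++ (elems u) (elems v)))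
elems-++ (false ∷ u) v = trans (cong (map suc) (elems-++ u v)) (map-suc-++ (elems u) (elems v))

lookup-injective : ∀ {A : Set} {xs : List A} → Unique xs →
                   ∀ {i j} → List.lookup xs i ≡ List.lookup xs j → i ≡ j
lookup-injective (x∉xs ∷ u) {zero}  {zero}  e = refl
lookup-injective (x∉xs ∷ u) {zero}  {suc j} e = ⊥-elim (All.lookup x∉xs (∈-lookup j) e)
lookup-injective (x∉xs ∷ u) {suc i} {zero}  e = ⊥-elim (All.lookup x∉xs (∈-lookup i) (sym e))
lookup-injective (x∉xs ∷ u) {suc i} {suc j} e = cong suc (lookup-injective u e)

lookup-cast-map : ∀ {A B : Set} (f : A → B) (xs : List A) {ys} → ys ≡ map f xs →
  .(eq : length xs ≡ length ys) → ∀ i → List.lookup ys (cast eq i) ≡ f (List.lookup xs i)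
lookup-cast-map f (x ∷ xs) refl eq zero    = refl
lookup-cast-map f (x ∷ xs) refl eq (suc i) = lookup-cast-map f xs refl (cong pred eq) i

-- The rows combine b x (x ∈ X). They come in the order of X, so the submatrix
-- they cut out is the identity itself rather than a row permutation of it.
block : ∀ {m n} → Fin m → Subset n → Subset (m * n)
block {suc m} zero    X = X ++ ⊥
block {suc m} (suc b) X = ⊥ ++ block b X

elems-block : ∀ {m n} (b : Fin m) (X : Subset n) → elems (block b X) ≡ map (combine b) (elems X)
elems-block {suc m} {n} zero X
  rewrite elems-++ X (⊥ {m * n}) | elems-⊥ (m * n) = ++-identityʳ _
elems-block {suc m} {n} (suc b) X
  rewrite elems-++ (⊥ {n}) (block b X) | elems-⊥ n | elems-block b X = sym (map-∘ (elems X))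

allSubsets : ∀ n → List (Subset n)
allSubsets zero    = [] ∷ []
allSubsets (suc n) = cartesianProductWith _∷_ (true ∷ false ∷ []) (allSubsets n)

∈-allSubsets : ∀ {n} (X : Subset n) → X ∈ allSubsets n
∈-allSubsets []          = here refl
∈-allSubsets (true ∷ X)  =
  ∈-cartesianProductWith⁺ _∷_ {xs = true ∷ false ∷ []} (here refl) (∈-allSubsets X)
∈-allSubsets (false ∷ X) =
  ∈-cartesianProductWith⁺ _∷_ {xs = true ∷ false ∷ []} (there (here refl)) (∈-allSubsets X)

⊈⇒∃∉ : ∀ {n} {X J : Subset n} → ¬ X ⊆ J → ∃ λ x → x ∈ₛ X × x ∉ₛ J
⊈⇒∃∉ {n} {X} {J} X⊈J
  with ¬∀⟶∃¬ n (λ x → x ∈ₛ X → x ∈ₛ J) (λ x → x ∈? X →-dec x ∈? J) (λ X⊆J → X⊈J (X⊆J _))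
... | x , ¬[x∈X→x∈J] =
  x , decidable-stable (x ∈? X) (λ x∉X → ¬[x∈X→x∈J] (⊥-elim ∘ x∉X)) , λ x∈J → ¬[x∈X→x∈J] (λ _ → x∈J)

module Representation {n} (H : Hereditary n) where
  open Hereditary H

  entry : Subset n → Fin n → Fin n → 𝕊
  entry J j x =
    if indep J ∧ does (j ∈? J)
    then (if does (j ≟ x) then 𝟙 else if does (x ∈? J) then 𝟘 else 𝟙ν)
    else 𝟘

  module _ {J j} (J-indep : T (indep J)) (j∈J : j ∈ₛ J) where

    private
      active : indep J ∧ does (j ∈? J) ≡ true
      active rewrite Equivalence.to T-≡ J-indep | dec-true (j ∈? J) j∈J = refl

    entry-pivot : entry J j j ≡ 𝟙
    entry-pivot rewrite active | dec-true (j ≟ j) refl = refl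

    entry-inside : ∀ {x} → x ∈ₛ J → j ≢ x → entry J j x ≡ 𝟘
    entry-inside {x} x∈J j≢x
      rewrite active | dec-false (j ≟ x) j≢x | dec-true (x ∈? J) x∈J = refl

    entry-outside : ∀ {x} → x ∉ₛ J → entry J j x ≡ 𝟙ν
    entry-outside {x} x∉J
      rewrite active | dec-false (j ≟ x) (λ { refl → x∉J j∈J }) | dec-false (x ∈? J) x∉J = refl

  entry≡𝟙⇒ : ∀ J j x → entry J j x ≡ 𝟙 → T (indep J) × j ∈ₛ J
  entry≡𝟙⇒ J j x e with indep J | j ∈? J
  ... | true  | yes j∈J = _ , j∈J
  ... | true  | no _    = ⊥-elim (𝟘≢𝟙 e)
  ... | false | _       = ⊥-elim (𝟘≢𝟙 e)

  dependent-escapes : ∀ {X J} → ¬ T (indep X) → T (indep J) → ∃ λ x → x ∈ₛ X × x ∉ₛ J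
  dependent-escapes X-dependent J-indep = ⊈⇒∃∉ (λ X⊆J → X-dependent (downclosed X⊆J J-indep))

  Subsets : ℕ
  Subsets = length (allSubsets n)

  rowSubset : Fin (Subsets * n) → Subset n
  rowSubset r = List.lookup (allSubsets n) (proj₁ (remQuot {Subsets} n r))

  rowPivot : Fin (Subsets * n) → Fin n
  rowPivot r = proj₂ (remQuot {Subsets} n r)

  matrix : Fin (Subsets * n) → Fin n → 𝕊
  matrix r = entry (rowSubset r) (rowPivot r)

  matrix-combine : ∀ (b : Fin Subsets) j →
                   matrix (combine b j) ≡ entry (List.lookup (allSubsets n) b) j
  matrix-combine b j = cong (λ (b , j) → entry (List.lookup (allSubsets n) b) j) (remQuot-combine b j)

  independent⇒nonsingular : ∀ X → T (indep X) → HasNonsingularSub matrix X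
  independent⇒nonsingular X X-indep = block b X , |Y|≡|X| , per-identity M diagonal offDiagonal
    where
    b : Fin Subsets
    b = Any.index (∈-allSubsets X)

    elems-Y : elems (block b X) ≡ map (combine b) (elems X)
    elems-Y = elems-block b X

    |Y|≡|X| : length (elems (block b X)) ≡ length (elems X)
    |Y|≡|X| = trans (cong length elems-Y) (length-map (combine b) (elems X))

    M = subMatrix matrix (block b X) X |Y|≡|X|

    x : Fin (length (elems X)) → Fin n
    x = List.lookup (elems X)

    M-entry : ∀ i j → M i j ≡ entry X (x i) (x j)
    M-entry i j = begin
      matrix (List.lookup (elems (block b X)) (cast (sym |Y|≡|X|) i)) (x j)
        ≡⟨ cong (λ r → matrix r (x j)) (lookup-cast-map (combine b) (elems X) elems-Y (sym |Y|≡|X|) i) ⟩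
      matrix (combine b (x i)) (x j)
        ≡⟨ cong (λ row → row (x j)) (matrix-combine b (x i)) ⟩
      entry (List.lookup (allSubsets n) b) (x i) (x j)
        ≡⟨ cong (λ J → entry J (x i) (x j)) (sym (lookup-index (∈-allSubsets X))) ⟩
      entry X (x i) (x j) ∎
      where open ≡-Reasoning

    x∈X : ∀ i → x i ∈ₛ X
    x∈X i = elems-sound X (∈-lookup i)

    diagonal : ∀ i → M i i ≡ 𝟙
    diagonal i = trans (M-entry i i) (entry-pivot X-indep (x∈X i))

    offDiagonal : ∀ i j → i ≢ j → M i j ≡ 𝟘
    offDiagonal i j i≢j = trans (M-entry i j)
      (entry-inside X-indep (x∈X i) (x∈X j) (i≢j ∘ lookup-injective (elems-unique X)))

  dependent⇒singular : ∀ X → ¬ T (indep X) → ¬ HasNonsingularSub matrix X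
  dependent⇒singular X X-dependent (Y , |Y|≡|X| , per≡𝟙)
    with per≡𝟙⇒ (subMatrix matrix Y X |Y|≡|X|) per≡𝟙
  ... | π , π∈perms , diagonal =
    𝟙≢𝟙ν (trans (sym per≡𝟙) (per-𝟙ν M π π∈perms nonzero escape hit x₀))
    where
    M = subMatrix matrix Y X |Y|≡|X|

    escapeIndex : ∀ {J} → T (indep J) → ∃ λ d → List.lookup (elems X) d ∉ₛ J
    escapeIndex J-indep with dependent-escapes X-dependent J-indep
    ... | x , x∈X , x∉J = Any.index x∈elems , subst (_∉ₛ _) (lookup-index x∈elems) x∉J
      where x∈elems = elems-complete X x∈X

    row : Fin (length (elems X)) → Fin (Subsets * n)
    row c = List.lookup (elems Y) (cast (sym |Y|≡|X|) (Vec.lookup π c))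

    rowActive : ∀ c → T (indep (rowSubset (row c))) × rowPivot (row c) ∈ₛ rowSubset (row c)
    rowActive c = entry≡𝟙⇒ _ _ _ (diagonal c)

    rowIndep : ∀ c → T (indep (rowSubset (row c)))
    rowIndep c = proj₁ (rowActive c)

    escape : Fin (length (elems X)) → Fin (length (elems X))
    escape c = proj₁ (escapeIndex (rowIndep c))

    hit : ∀ c → M (Vec.lookup π c) (escape c) ≡ 𝟙ν
    hit c = entry-outside (rowIndep c) (proj₂ (rowActive c)) (proj₂ (escapeIndex (rowIndep c)))

    nonzero : ∀ c → M (Vec.lookup π c) c ≢ 𝟘
    nonzero c M≡𝟘 = 𝟘≢𝟙 (trans (sym M≡𝟘) (diagonal c))

    x₀ : Fin (length (elems X))
    x₀ = proj₁ (escapeIndex (proj₂ nonempty))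

  represents : Represents matrix H
  represents X = mk⇔ (independent⇒nonsingular X) λ nonsingular →
    decidable-stable (T? (indep X)) (λ X-dependent → dependent⇒singular X X-dependent nonsingular)

theorem4p6 : (n : ℕ) (H : Hereditary n) →
    Σ ℕ (λ m → Σ (Fin m → Fin n → 𝕊) (λ A → Represents A H))
theorem4p6 n H = Subsets * n , matrix , represents
  where open Representation H
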